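{- Let $q$ be a prime power, let $s$ be a positive divisor of $q-1$, let $r$ be a positive integer with $s\nmid r$, let $B(X)\in\mathbb{F}_q[X]$, and let $f(X)=X^rB(X^s)$. For any $a\in\mathbb{F}_q$, the polynomial $g(X):=f(X)+a$ satisfies $S(g)=a\cdot|f(\mathbb{F}_q)|$.
   Context: For $f(X)\in\mathbb{F}_q[X]$, $f(\mathbb{F}_q)=\{f(x):x\in\mathbb{F}_q\}$ is the value set and $S(f)$ denotes the sum of its elements (each value counted once). The integer $|f(\mathbb{F}_q)|$ is interpreted in $\mathbb{F}_q$. -}

module Defs where

open import Level using (0ℓ)
open import Data.Nat using (ℕ; zero; suc)
open import Data.List using (List; []; _∷_; map; length; deduplicate; foldr)
open import Data.List.Membership.Setoid using ()
open import Data.List.Relation.Unary.Any using (Any)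
open import Data.List.Relation.Unary.AllPairs using (AllPairs)
open import Data.Product using (Σ; _×_)
open import Relation.Nullary using (¬_)
open import Relation.Binary.Definitions using (Decidable)
open import Algebra.Bundles using (CommutativeRing)

record FiniteField : Set₁ where
  field
    commRing : CommutativeRing 0ℓ 0ℓ
  open CommutativeRing commRing public
  field
    _≟_      : Decidable _≈_
    1≉0      : ¬ (1# ≈ 0#)
    inverse  : ∀ x → ¬ (x ≈ 0#) → Σ Carrier (λ y → x * y ≈ 1#)
    elements : List Carrier
    complete : ∀ x → Any (x ≈_) elements
    distinct : AllPairs (λ x y → ¬ (x ≈ y)) elements

module _ (F : FiniteField) where
  open FiniteField F

  order : ℕ
  order = length elements

  pow : Carrier → ℕ → Carrier
  pow x zero    = 1#
  pow x (suc n) = x * pow x n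

  fromℕ : ℕ → Carrier
  fromℕ zero    = 0#
  fromℕ (suc n) = 1# + fromℕ n

  -- polynomials as coefficient lists [b₀, b₁, …, bₙ] ↦ b₀ + b₁X + … + bₙXⁿ
  Poly : Set
  Poly = List Carrier

  eval : Poly → Carrier → Carrier
  eval p x = foldr (λ c acc → c + x * acc) 0# p

  valueSet : (Carrier → Carrier) → List Carrier
  valueSet f = deduplicate _≟_ (map f elements)

  sumList : List Carrier → Carrier
  sumList = foldr _+_ 0#

  S : (Carrier → Carrier) → Carrier
  S f = sumList (valueSet f)

  card : (Carrier → Carrier) → ℕ
  card f = length (valueSet f)

  fPoly : ℕ → ℕ → Poly → Carrier → Carrier
  fPoly r s B x = pow x r * eval B (pow x s)

-- Since s ∣ q − 1 and s ∤ r, some u ∈ F_q^× has u^s = 1 but u^r ≠ 1: otherwise, with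
-- m = (q − 1)/s, every nonzero y would satisfy y^(m·(r mod s)) = 1 although
-- 0 < m·(r mod s) < q − 1, too many roots for a polynomial of that degree.
-- Then f(ux) = u^r f(x), so the value set V of f is stable under multiplication by
-- w = u^r ≠ 1; hence w·ΣV = ΣV and ΣV = 0. The value set of f + a is V + a, so
-- S(f + a) = ΣV + a·|V| = a·|V|.

module Submission where

open import Level using (0ℓ)
open import Defs
open import Data.Nat as ℕ using (ℕ; zero; suc; _∸_; _>_; _≤_; _<_; _%_; _/_; NonZero)
import Data.Nat.Properties as ℕ
open import Data.Nat.Divisibility using (_∣_; divides; m%n≡0⇒n∣m)
open import Data.Nat.DivMod using (m%n<n; m≡m%n+[m/n]*n)
open import Data.List using (List; []; _∷_; _++_; map; length; foldr; filter)
open import Data.List.Relation.Unary.Any using (here; there)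
open import Data.List.Relation.Unary.All as All using (all?)
open import Data.List.Relation.Unary.All.Properties using (¬All⇒Any¬)
open import Data.List.Relation.Unary.AllPairs using (_∷_; tail)
open import Data.Product using (∃-syntax; _×_; _,_; proj₁; proj₂)
open import Function using (_∘_)
open import Relation.Nullary using (¬_; yes; no; contradiction; ¬?)
open import Relation.Unary using (Decidable)
open import Relation.Binary using (Setoid; DecSetoid; _Preserves_⟶_; _Respects_)
open import Relation.Binary.PropositionalEquality as ≡ using (_≡_)
open import Algebra.Bundles using (CommutativeMonoid; Semiring)
import Data.List.Membership.Setoid as Membership
import Data.List.Relation.Binary.Equality.Setoid as Equality
import Data.List.Relation.Binary.Permutation.Setoid as Permutation
import Data.List.Relation.Binary.Subset.Setoid as Subset
import Data.List.Relation.Unary.Unique.Setoid as Unique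
open import Data.List.Membership.Setoid.Properties
  using (∈-resp-≈; ∈-∃++; ∈-map⁺; ∈-map⁻; ∈-filter⁺; ∈-filter⁻; ∈-length; ∉⇒All[≉];
         ∈-deduplicate⁺; ∈-deduplicate⁻)
open import Data.List.Relation.Binary.Permutation.Setoid.Properties
  using (Unique-resp-↭; ∈-resp-↭; shift; ↭-respˡ-≋; xs↭ys⇒|xs|≡|ys|; foldr-commMonoid)
open import Data.List.Relation.Unary.Unique.Setoid.Properties
  using (map⁺; filter⁺; Unique[x∷xs]⇒x∉xs)
open import Data.List.Relation.Unary.Unique.DecSetoid.Properties using (deduplicate-!)
import Algebra.Definitions.RawSemiring as RawSemiringDefinitions
import Algebra.Properties.Semiring.Exp as SemiringExp
import Algebra.Properties.CommutativeSemiring.Exp as CommutativeSemiringExp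
import Algebra.Properties.CommutativeSemigroup as CommutativeSemigroupProperties
import Algebra.Properties.AbelianGroup as AbelianGroupProperties
import Algebra.Properties.Ring as RingProperties
import Algebra.Solver.Ring.NaturalCoefficients.Default as NaturalCoefficientsSolver
import Relation.Binary.Reasoning.Setoid as ≈-Reasoning

module _ {c ℓ} (S : Setoid c ℓ) where
  open Setoid S
  open Membership S using (_∈_; _∉_)
  open Subset S using (_⊆_)
  open Permutation S using (_↭_; ↭-refl; ↭-sym; ↭-trans; ↭-prep)
  open Unique S using (Unique)
  open Equality S using (≋-sym)

  Unique-⊆-⊇⇒↭ : ∀ {xs ys} → Unique xs → Unique ys → xs ⊆ ys → ys ⊆ xs → xs ↭ ys
  Unique-⊆-⊇⇒↭ {[]}     {[]}    _ _ _ _     = ↭-refl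
  Unique-⊆-⊇⇒↭ {[]}     {_ ∷ _} _ _ _ ys⊆[] with ys⊆[] (here refl)
  ... | ()
  Unique-⊆-⊇⇒↭ {x ∷ xs} {ys} x∷xs! ys! x∷xs⊆ys ys⊆x∷xs
    with as , bs , w , x≈w , ys≋ ← ∈-∃++ S (x∷xs⊆ys (here refl)) =
    ↭-trans (↭-prep x (Unique-⊆-⊇⇒↭ (tail x∷xs!) (tail x∷rest!) xs⊆rest rest⊆xs)) (↭-sym ys↭x∷rest)
    where
    rest = as ++ bs
    ys↭x∷rest : ys ↭ x ∷ rest
    ys↭x∷rest = ↭-respˡ-≋ S (≋-sym ys≋) (shift S (sym x≈w) as bs)
    x∷rest! : Unique (x ∷ rest)
    x∷rest! = Unique-resp-↭ S ys↭x∷rest ys!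
    drop-x : ∀ {z zs ws} → x ∉ zs → z ∈ zs → z ∈ x ∷ ws → z ∈ ws
    drop-x x∉zs z∈zs (here z≈x) = contradiction (∈-resp-≈ S z≈x z∈zs) x∉zs
    drop-x _    _    (there z∈ws) = z∈ws
    xs⊆rest : xs ⊆ rest
    xs⊆rest z∈xs = drop-x (Unique[x∷xs]⇒x∉xs S x∷xs!) z∈xs
      (∈-resp-↭ S ys↭x∷rest (x∷xs⊆ys (there z∈xs)))
    rest⊆xs : rest ⊆ xs
    rest⊆xs z∈rest = drop-x (Unique[x∷xs]⇒x∉xs S x∷rest!) z∈rest
      (ys⊆x∷xs (∈-resp-↭ S (↭-sym ys↭x∷rest) (there z∈rest)))

module _ {c ℓ} (M : CommutativeMonoid c ℓ) where
  open CommutativeMonoid M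
  open Membership setoid using (_∈_)
  open Subset setoid using (_⊆_)
  open Unique setoid using (Unique)

  foldr-Unique-⊆-⊇ : ∀ {xs ys} → Unique xs → Unique ys → xs ⊆ ys → ys ⊆ xs →
                     foldr _∙_ ε xs ≈ foldr _∙_ ε ys
  foldr-Unique-⊆-⊇ xs! ys! xs⊆ys ys⊆xs =
    foldr-commMonoid setoid isCommutativeMonoid (Unique-⊆-⊇⇒↭ setoid xs! ys! xs⊆ys ys⊆xs)

module _ {c ℓ} (R : Semiring c ℓ) where
  open Semiring R
  open RawSemiringDefinitions rawSemiring using (_^_)
  open SemiringExp R using (^-congˡ; ^-homo-*; ^-assocʳ)
  open ≈-Reasoning setoid

  1#^n≈1# : ∀ n → 1# ^ n ≈ 1#
  1#^n≈1# zero    = refl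
  1#^n≈1# (suc n) = trans (*-identityˡ _) (1#^n≈1# n)

  x^s≈1⇒x^r≈x^[r%s] : ∀ {x} r s .{{_ : NonZero s}} → x ^ s ≈ 1# → x ^ r ≈ x ^ (r % s)
  x^s≈1⇒x^r≈x^[r%s] {x} r s x^s≈1 = begin
    x ^ r                             ≡⟨ ≡.cong (x ^_) (m≡m%n+[m/n]*n r s) ⟩
    x ^ (r % s ℕ.+ r / s ℕ.* s)       ≈⟨ ^-homo-* x (r % s) _ ⟩
    x ^ (r % s) * x ^ (r / s ℕ.* s)   ≡⟨ ≡.cong (λ k → x ^ (r % s) * x ^ k) (ℕ.*-comm (r / s) s) ⟩
    x ^ (r % s) * x ^ (s ℕ.* (r / s)) ≈⟨ *-congˡ (^-assocʳ x s (r / s)) ⟨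
    x ^ (r % s) * (x ^ s) ^ (r / s)   ≈⟨ *-congˡ (trans (^-congˡ (r / s) x^s≈1) (1#^n≈1# (r / s))) ⟩
    x ^ (r % s) * 1#                  ≈⟨ *-identityʳ _ ⟩
    x ^ (r % s)                       ∎

module _ (F : FiniteField) where
  open FiniteField F
  open RawSemiringDefinitions (Semiring.rawSemiring semiring) using (_^_)
  open SemiringExp semiring using (^-congˡ; ^-assocʳ)
  open CommutativeSemiringExp commutativeSemiring using (^-distrib-*)
  open CommutativeSemigroupProperties *-commutativeSemigroup using () renaming (interchange to *-interchange)
  open CommutativeSemigroupProperties +-commutativeSemigroup using () renaming (interchange to +-interchange)
  open AbelianGroupProperties +-abelianGroup using (x≈y⇒x∙y⁻¹≈ε; x∙y⁻¹≈ε⇒x≈y; ∙-cancelʳ)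
  open RingProperties ring using ([y-z]x≈yx-zx)
  open Membership setoid using (_∈_; _∉_; find)
  open Subset setoid using (_⊆_)
  open Unique setoid using (Unique)
  open NaturalCoefficientsSolver commutativeSemiring using (solve; _:+_; _:*_; _:=_)
  open ≈-Reasoning setoid

  module _ {x} (x≉0 : x ≉ 0#) where
    x⁻¹ : Carrier
    x⁻¹ = proj₁ (inverse x x≉0)

    x*[x⁻¹*y]≈y : ∀ y → x * (x⁻¹ * y) ≈ y
    x*[x⁻¹*y]≈y y = begin
      x * (x⁻¹ * y) ≈⟨ *-assoc x x⁻¹ y ⟨
      (x * x⁻¹) * y ≈⟨ *-congʳ (proj₂ (inverse x x≉0)) ⟩
      1# * y        ≈⟨ *-identityˡ y ⟩
      y             ∎

    x⁻¹*[x*y]≈y : ∀ y → x⁻¹ * (x * y) ≈ y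
    x⁻¹*[x*y]≈y y = begin
      x⁻¹ * (x * y) ≈⟨ *-assoc x⁻¹ x y ⟨
      (x⁻¹ * x) * y ≈⟨ *-congʳ (*-comm x⁻¹ x) ⟩
      (x * x⁻¹) * y ≈⟨ *-assoc x x⁻¹ y ⟩
      x * (x⁻¹ * y) ≈⟨ x*[x⁻¹*y]≈y y ⟩
      y             ∎

    *-cancelˡ-≉0 : ∀ {y z} → x * y ≈ x * z → y ≈ z
    *-cancelˡ-≉0 {y} {z} xy≈xz = begin
      y             ≈⟨ x⁻¹*[x*y]≈y y ⟨
      x⁻¹ * (x * y) ≈⟨ *-congˡ xy≈xz ⟩
      x⁻¹ * (x * z) ≈⟨ x⁻¹*[x*y]≈y z ⟩
      z             ∎

  *-≉0 : ∀ {x y} → x ≉ 0# → y ≉ 0# → x * y ≉ 0#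
  *-≉0 {x} x≉0 y≉0 xy≈0 = y≉0 (*-cancelˡ-≉0 x≉0 (trans xy≈0 (sym (zeroʳ x))))

  *-cancelʳ-≉ : ∀ {x y z} → x ≉ y → x * z ≈ y * z → z ≈ 0#
  *-cancelʳ-≉ {x} {y} {z} x≉y xz≈yz = *-cancelˡ-≉0 x-y≉0 (begin
    (x - y) * z     ≈⟨ [y-z]x≈yx-zx z x y ⟩
    x * z - y * z   ≈⟨ x≈y⇒x∙y⁻¹≈ε xz≈yz ⟩
    0#              ≈⟨ zeroʳ (x - y) ⟨
    (x - y) * 0#    ∎)
    where
    x-y≉0 : x - y ≉ 0#
    x-y≉0 = x≉y ∘ x∙y⁻¹≈ε⇒x≈y x y

  pow≈^ : ∀ x n → pow F x n ≈ x ^ n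
  pow≈^ x zero    = refl
  pow≈^ x (suc n) = *-congˡ (pow≈^ x n)

  ^-≉0 : ∀ {x} → x ≉ 0# → ∀ n → x ^ n ≉ 0#
  ^-≉0 x≉0 zero    = 1≉0
  ^-≉0 x≉0 (suc n) = *-≉0 x≉0 (^-≉0 x≉0 n)

  nonzero? : Decidable (_≉ 0#)
  nonzero? x = ¬? (x ≟ 0#)

  ≉0-resp-≈ : (_≉ 0#) Respects _≈_
  ≉0-resp-≈ x≈y x≉0 y≈0 = x≉0 (trans x≈y y≈0)

  nonzeros : List Carrier
  nonzeros = filter nonzero? elements

  nonzeros-! : Unique nonzeros
  nonzeros-! = filter⁺ setoid nonzero? distinct

  ∈-nonzeros⁺ : ∀ {x} → x ≉ 0# → x ∈ nonzeros
  ∈-nonzeros⁺ {x} = ∈-filter⁺ setoid nonzero? ≉0-resp-≈ (complete x)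

  ∈-nonzeros⁻ : ∀ {x} → x ∈ nonzeros → x ≉ 0#
  ∈-nonzeros⁻ = proj₂ ∘ ∈-filter⁻ setoid nonzero? ≉0-resp-≈ {xs = elements}

  order≡1+|nonzeros| : order F ≡ suc (length nonzeros)
  order≡1+|nonzeros| = xs↭ys⇒|xs|≡|ys| setoid
    (Unique-⊆-⊇⇒↭ setoid distinct (∉⇒All[≉] setoid 0∉nonzeros ∷ nonzeros-!) ⊆0∷nonzeros 0∷nonzeros⊆)
    where
    0∉nonzeros : 0# ∉ nonzeros
    0∉nonzeros 0∈ = ∈-nonzeros⁻ 0∈ refl
    ⊆0∷nonzeros : elements ⊆ 0# ∷ nonzeros
    ⊆0∷nonzeros {x} _ with x ≟ 0#
    ... | yes x≈0 = here x≈0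
    ... | no x≉0  = there (∈-nonzeros⁺ x≉0)
    0∷nonzeros⊆ : 0# ∷ nonzeros ⊆ elements
    0∷nonzeros⊆ {x} _ = complete x

  product : List Carrier → Carrier
  product = foldr _*_ 1#

  product-map-* : ∀ y xs → product (map (y *_) xs) ≈ y ^ length xs * product xs
  product-map-* y []       = sym (*-identityˡ 1#)
  product-map-* y (x ∷ xs) = begin
    (y * x) * product (map (y *_) xs)         ≈⟨ *-congˡ (product-map-* y xs) ⟩
    (y * x) * (y ^ length xs * product xs)    ≈⟨ *-interchange y x _ _ ⟩
    (y * y ^ length xs) * (x * product xs)    ∎

  product-≉0 : ∀ xs → (∀ {x} → x ∈ xs → x ≉ 0#) → product xs ≉ 0#
  product-≉0 []       _      = 1≉0
  product-≉0 (x ∷ xs) xs≉0 = *-≉0 (xs≉0 (here refl)) (product-≉0 xs (xs≉0 ∘ there))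

  fermat : ∀ {y} → y ≉ 0# → y ^ length nonzeros ≈ 1#
  fermat {y} y≉0 = *-cancelˡ-≉0 (product-≉0 nonzeros ∈-nonzeros⁻) (begin
    P * y ^ length nonzeros           ≈⟨ *-comm P _ ⟩
    y ^ length nonzeros * P           ≈⟨ product-map-* y nonzeros ⟨
    product (map (y *_) nonzeros)     ≈⟨ foldr-Unique-⊆-⊇ *-commutativeMonoid
                                           (map⁺ setoid setoid (*-cancelˡ-≉0 y≉0) nonzeros-!) nonzeros-!
                                           y*nonzeros⊆nonzeros nonzeros⊆y*nonzeros ⟩
    P                                 ≈⟨ *-identityʳ P ⟨
    P * 1#                            ∎)
    where
    P = product nonzeros
    y*nonzeros⊆nonzeros : map (y *_) nonzeros ⊆ nonzeros
    y*nonzeros⊆nonzeros z∈ with x , x∈ , z≈yx ← ∈-map⁻ setoid setoid z∈ =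
      ∈-nonzeros⁺ (≉0-resp-≈ (sym z≈yx) (*-≉0 y≉0 (∈-nonzeros⁻ x∈)))
    nonzeros⊆y*nonzeros : nonzeros ⊆ map (y *_) nonzeros
    nonzeros⊆y*nonzeros {z} z∈ = ∈-resp-≈ setoid (x*[x⁻¹*y]≈y y≉0 z)
      (∈-map⁺ setoid setoid *-congˡ (∈-nonzeros⁺ y⁻¹z≉0))
      where
      y⁻¹z≉0 : x⁻¹ y≉0 * z ≉ 0#
      y⁻¹z≉0 y⁻¹z≈0 = ∈-nonzeros⁻ z∈ (trans (sym (x*[x⁻¹*y]≈y y≉0 z)) (trans (*-congˡ y⁻¹z≈0) (zeroʳ y)))

  eval-cong : ∀ p → eval F p Preserves _≈_ ⟶ _≈_
  eval-cong []      x≈y = refl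
  eval-cong (c ∷ p) x≈y = +-congˡ (*-cong x≈y (eval-cong p x≈y))

  quot : Carrier → Poly F → Poly F
  quot a []          = []
  quot a (c ∷ [])    = []
  quot a (c ∷ d ∷ p) = eval F (d ∷ p) a ∷ quot a (d ∷ p)

  length-quot : ∀ a c p → length (quot a (c ∷ p)) ≡ length p
  length-quot a c []      = ≡.refl
  length-quot a c (d ∷ p) = ≡.cong suc (length-quot a d p)

  -- Synthetic division by X − a: p(x) − p(a) = (x − a)·(quot a p)(x), with both
  -- subtractions moved across so that the semiring solver applies.
  eval-quot : ∀ a p x → eval F p x + a * eval F (quot a p) x ≈ x * eval F (quot a p) x + eval F p a
  eval-quot a []          x = begin
    0# + a * 0#  ≈⟨ +-congˡ (zeroʳ a) ⟩
    0# + 0#      ≈⟨ +-congˡ (zeroʳ x) ⟨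
    0# + x * 0#  ≈⟨ +-comm 0# _ ⟩
    x * 0# + 0#  ∎
  eval-quot a (c ∷ [])    x = begin
    (c + x * 0#) + a * 0# ≈⟨ +-cong (+-congˡ (zeroʳ x)) (zeroʳ a) ⟩
    (c + 0#) + 0#         ≈⟨ +-comm _ 0# ⟩
    0# + (c + 0#)         ≈⟨ +-cong (zeroʳ x) (+-congˡ (zeroʳ a)) ⟨
    x * 0# + (c + a * 0#) ∎
  eval-quot a (c ∷ d ∷ p) x = begin
    (c + x * P x) + a * (P a + x * Q x)  ≈⟨ rearrange c x (P x) a (P a) (Q x) ⟩
    (c + a * P a) + x * (P x + a * Q x)  ≈⟨ +-congˡ (*-congˡ (eval-quot a (d ∷ p) x)) ⟩
    (c + a * P a) + x * (x * Q x + P a)  ≈⟨ +-comm _ _ ⟩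
    x * (x * Q x + P a) + (c + a * P a)  ≈⟨ +-congʳ (*-congˡ (+-comm _ _)) ⟩
    x * (P a + x * Q x) + (c + a * P a)  ∎
    where
    P Q : Carrier → Carrier
    P = eval F (d ∷ p)
    Q = eval F (quot a (d ∷ p))
    rearrange : ∀ c x Px a Pa Qx → (c + x * Px) + a * (Pa + x * Qx) ≈ (c + a * Pa) + x * (Px + a * Qx)
    rearrange = solve 6 (λ c x Px a Pa Qx →
      (c :+ x :* Px) :+ a :* (Pa :+ x :* Qx) := (c :+ a :* Pa) :+ x :* (Px :+ a :* Qx)) refl

  quot-root : ∀ {a b} p → eval F p a ≈ 0# → eval F p b ≈ 0# → a ≉ b → eval F (quot a p) b ≈ 0#
  quot-root {a} {b} p pa≈0 pb≈0 a≉b = *-cancelʳ-≉ a≉b (begin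
    a * Q                 ≈⟨ +-identityˡ _ ⟨
    0# + a * Q            ≈⟨ +-congʳ pb≈0 ⟨
    eval F p b + a * Q    ≈⟨ eval-quot a p b ⟩
    b * Q + eval F p a    ≈⟨ +-congˡ pa≈0 ⟩
    b * Q + 0#            ≈⟨ +-identityʳ _ ⟩
    b * Q                 ∎)
    where Q = eval F (quot a p) b

  quot-vanishes⇒vanishes : ∀ {a} p → eval F p a ≈ 0# → (∀ x → eval F (quot a p) x ≈ 0#) →
                           ∀ x → eval F p x ≈ 0#
  quot-vanishes⇒vanishes {a} p pa≈0 q≈0 x = begin
    eval F p x                                ≈⟨ +-identityʳ _ ⟨
    eval F p x + 0#                           ≈⟨ +-congˡ (trans (*-congˡ (q≈0 x)) (zeroʳ a)) ⟨
    eval F p x + a * eval F (quot a p) x      ≈⟨ eval-quot a p x ⟩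
    x * eval F (quot a p) x + eval F p a      ≈⟨ +-cong (trans (*-congˡ (q≈0 x)) (zeroʳ x)) pa≈0 ⟩
    0# + 0#                                   ≈⟨ +-identityʳ 0# ⟩
    0#                                        ∎

  vanishes-on-distinct⇒vanishes : ∀ {L} → Unique L → ∀ p → length p ≤ length L →
                                  (∀ {x} → x ∈ L → eval F p x ≈ 0#) → ∀ x → eval F p x ≈ 0#
  vanishes-on-distinct⇒vanishes _ [] _ _ _ = refl
  vanishes-on-distinct⇒vanishes {a ∷ L} a∷L! (c ∷ p) (ℕ.s≤s |p|≤|L|) L-roots =
    quot-vanishes⇒vanishes (c ∷ p) (L-roots (here refl))
      (vanishes-on-distinct⇒vanishes (tail a∷L!) (quot a (c ∷ p))
        (≡.subst (_≤ length L) (≡.sym (length-quot a c p)) |p|≤|L|)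
        (λ b∈L → quot-root (c ∷ p) (L-roots (here refl)) (L-roots (there b∈L))
          (λ a≈b → Unique[x∷xs]⇒x∉xs setoid a∷L! (∈-resp-≈ setoid (sym a≈b) b∈L))))

  monomial : ℕ → Poly F
  monomial zero    = 1# ∷ []
  monomial (suc k) = 0# ∷ monomial k

  length-monomial : ∀ k → length (monomial k) ≡ suc k
  length-monomial zero    = ≡.refl
  length-monomial (suc k) = ≡.cong suc (length-monomial k)

  eval-monomial : ∀ k x → eval F (monomial k) x ≈ x ^ k
  eval-monomial zero    x = trans (+-congˡ (zeroʳ x)) (+-identityʳ 1#)
  eval-monomial (suc k) x = trans (+-identityˡ _) (*-congˡ (eval-monomial k x))

  ∀x^k≈1⇒|nonzeros|≤k : ∀ k → (∀ {y} → y ≉ 0# → y ^ k ≈ 1#) → 0 < k → length nonzeros ≤ k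
  ∀x^k≈1⇒|nonzeros|≤k (suc j) roots _ = ℕ.≮⇒≥ λ k<|nonzeros| → 1≉0 (begin
    1#               ≈⟨ +-identityʳ 1# ⟨
    1# + 0#          ≈⟨ +-congˡ (vanishes k<|nonzeros| 0#) ⟨
    1# + eval F p 0# ≈⟨ +-congˡ (+-congˡ (zeroˡ _)) ⟩
    1# + (- 1# + 0#) ≈⟨ +-congˡ (+-identityʳ (- 1#)) ⟩
    1# - 1#          ≈⟨ -‿inverseʳ 1# ⟩
    0#               ∎)
    where
    p : Poly F
    p = - 1# ∷ monomial j
    root : ∀ {y} → y ≉ 0# → eval F p y ≈ 0#
    root {y} y≉0 = begin
      - 1# + y * eval F (monomial j) y ≈⟨ +-congˡ (*-congˡ (eval-monomial j y)) ⟩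
      - 1# + y ^ suc j                 ≈⟨ +-congˡ (roots y≉0) ⟩
      - 1# + 1#                        ≈⟨ -‿inverseˡ 1# ⟩
      0#                               ∎
    vanishes : suc j < length nonzeros → ∀ x → eval F p x ≈ 0#
    vanishes k<|nonzeros| = vanishes-on-distinct⇒vanishes nonzeros-! p
      (≡.subst (_≤ length nonzeros) (≡.sym (≡.cong suc (length-monomial j))) k<|nonzeros|)
      (root ∘ ∈-nonzeros⁻)

  ∃-y^k≉1 : ∀ {k} → 0 < k → k < length nonzeros → ∃[ y ] y ≉ 0# × y ^ k ≉ 1#
  ∃-y^k≉1 {k} 0<k k<|nonzeros| with all? (λ y → (y ^ k) ≟ 1#) nonzeros
  ... | yes all = contradiction (∀x^k≈1⇒|nonzeros|≤k k (All.lookupₛ setoid resp all ∘ ∈-nonzeros⁺) 0<k)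
                               (ℕ.<⇒≱ k<|nonzeros|)
    where
    resp : (λ y → y ^ k ≈ 1#) Respects _≈_
    resp x≈y x^k≈1 = trans (^-congˡ k (sym x≈y)) x^k≈1
  ... | no ¬all with y , y∈ , y^k≉1 ← find (¬All⇒Any¬ (λ y → (y ^ k) ≟ 1#) nonzeros ¬all) =
    y , ∈-nonzeros⁻ y∈ , y^k≉1

  ∃u^s≈1∧u^r≉1 : ∀ {s r} → 0 < s → s ∣ order F ∸ 1 → ¬ s ∣ r →
                    ∃[ u ] u ≉ 0# × u ^ s ≈ 1# × u ^ r ≉ 1#
  ∃u^s≈1∧u^r≉1 {s} {r} 0<s (divides m q-1≡m*s) s∤r = root-from (∃-y^k≉1 0<K K<|nonzeros|)
    where
    instance
      s≢0 : NonZero s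
      s≢0 = ℕ.>-nonZero 0<s
    K : ℕ
    K = m ℕ.* (r % s)
    |nonzeros|≡m*s : length nonzeros ≡ m ℕ.* s
    |nonzeros|≡m*s = ≡.trans (≡.cong (_∸ 1) (≡.sym order≡1+|nonzeros|)) q-1≡m*s
    instance
      m≢0 : NonZero m
      m≢0 = ℕ.m*n≢0⇒m≢0 m {{ℕ.>-nonZero (≡.subst (0 <_) |nonzeros|≡m*s (∈-length setoid (∈-nonzeros⁺ 1≉0)))}}
      r%s≢0 : NonZero (r % s)
      r%s≢0 = ℕ.≢-nonZero (s∤r ∘ m%n≡0⇒n∣m r s)
    0<K : 0 < K
    0<K = ℕ.>-nonZero⁻¹ K {{ℕ.m*n≢0 m (r % s)}}
    K<|nonzeros| : K < length nonzeros
    K<|nonzeros| = ≡.subst (K <_) (≡.sym |nonzeros|≡m*s) (ℕ.*-monoʳ-< m (m%n<n r s))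
    root-from : ∃[ y ] y ≉ 0# × y ^ K ≉ 1# → ∃[ u ] u ≉ 0# × u ^ s ≈ 1# × u ^ r ≉ 1#
    root-from (y , y≉0 , y^K≉1) = y ^ m , ^-≉0 y≉0 m , y^m^s≈1 , λ y^m^r≈1 → y^K≉1 (begin
      y ^ K               ≈⟨ ^-assocʳ y m (r % s) ⟨
      (y ^ m) ^ (r % s)   ≈⟨ x^s≈1⇒x^r≈x^[r%s] semiring r s y^m^s≈1 ⟨
      (y ^ m) ^ r         ≈⟨ y^m^r≈1 ⟩
      1#                  ∎)
      where
      y^m^s≈1 : (y ^ m) ^ s ≈ 1#
      y^m^s≈1 = trans (^-assocʳ y m s) (trans (reflexive (≡.cong (y ^_) (≡.sym |nonzeros|≡m*s))) (fermat y≉0))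

  decSetoid : DecSetoid 0ℓ 0ℓ
  decSetoid = record { isDecEquivalence = record { isEquivalence = isEquivalence ; _≟_ = _≟_ } }

  valueSet-! : ∀ h → Unique (valueSet F h)
  valueSet-! h = deduplicate-! decSetoid (map h elements)

  ∈-valueSet⁺ : ∀ {h} → h Preserves _≈_ ⟶ _≈_ → ∀ x → h x ∈ valueSet F h
  ∈-valueSet⁺ h-cong x =
    ∈-deduplicate⁺ setoid _≟_ (λ y≈z x≈z → trans x≈z (sym y≈z)) (∈-map⁺ setoid setoid h-cong (complete x))

  ∈-valueSet⁻ : ∀ {h z} → z ∈ valueSet F h → ∃[ x ] z ≈ h x
  ∈-valueSet⁻ {h} z∈ with x , _ , z≈hx ← ∈-map⁻ setoid setoid (∈-deduplicate⁻ setoid _≟_ (map h elements) z∈) =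
    x , z≈hx

  ∈-map-valueSet⁻ : ∀ {g h z} → g Preserves _≈_ ⟶ _≈_ → z ∈ map g (valueSet F h) → ∃[ x ] z ≈ g (h x)
  ∈-map-valueSet⁻ g-cong z∈ with v , v∈ , z≈gv ← ∈-map⁻ setoid setoid z∈ =
    let x , v≈hx = ∈-valueSet⁻ v∈ in x , trans z≈gv (g-cong v≈hx)

  sum-map-+ : ∀ a xs → sumList F (map (_+ a) xs) ≈ sumList F xs + a * fromℕ F (length xs)
  sum-map-+ a []       = sym (trans (+-identityˡ _) (zeroʳ a))
  sum-map-+ a (x ∷ xs) = begin
    (x + a) + sumList F (map (_+ a) xs)    ≈⟨ +-congˡ (sum-map-+ a xs) ⟩
    (x + a) + (σ + a * n)                  ≈⟨ +-interchange x a σ _ ⟩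
    (x + σ) + (a + a * n)                  ≈⟨ +-congˡ (+-congʳ (*-identityʳ a)) ⟨
    (x + σ) + (a * 1# + a * n)             ≈⟨ +-congˡ (distribˡ a 1# n) ⟨
    (x + σ) + a * (1# + n)                 ∎
    where
    σ = sumList F xs
    n = fromℕ F (length xs)

  sum-map-* : ∀ w xs → sumList F (map (w *_) xs) ≈ w * sumList F xs
  sum-map-* w []       = sym (zeroʳ w)
  sum-map-* w (x ∷ xs) = trans (+-congˡ (sum-map-* w xs)) (sym (distribˡ w x _))

  S-translate : ∀ {h} → h Preserves _≈_ ⟶ _≈_ → ∀ a → S F (λ x → h x + a) ≈ S F h + a * fromℕ F (card F h)
  S-translate {h} h-cong a = begin
    sumList F (valueSet F (λ x → h x + a)) ≈⟨ foldr-Unique-⊆-⊇ +-commutativeMonoid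
                                                (valueSet-! _) V+a-! V[h+a]⊆V+a V+a⊆V[h+a] ⟩
    sumList F (map (_+ a) (valueSet F h))  ≈⟨ sum-map-+ a (valueSet F h) ⟩
    S F h + a * fromℕ F (card F h)         ∎
    where
    V+a-! : Unique (map (_+ a) (valueSet F h))
    V+a-! = map⁺ setoid setoid (∙-cancelʳ a _ _) (valueSet-! h)
    V[h+a]⊆V+a : valueSet F (λ x → h x + a) ⊆ map (_+ a) (valueSet F h)
    V[h+a]⊆V+a z∈ with x , z≈hx+a ← ∈-valueSet⁻ z∈ =
      ∈-resp-≈ setoid (sym z≈hx+a) (∈-map⁺ setoid setoid +-congʳ (∈-valueSet⁺ h-cong x))
    V+a⊆V[h+a] : map (_+ a) (valueSet F h) ⊆ valueSet F (λ x → h x + a)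
    V+a⊆V[h+a] z∈ with x , z≈hx+a ← ∈-map-valueSet⁻ +-congʳ z∈ =
      ∈-resp-≈ setoid (sym z≈hx+a) (∈-valueSet⁺ (+-congʳ ∘ h-cong) x)

  S-homogeneous≈0 : ∀ {h u w} → h Preserves _≈_ ⟶ _≈_ → u ≉ 0# → w ≉ 0# → w ≉ 1# →
                    (∀ x → h (u * x) ≈ w * h x) → S F h ≈ 0#
  S-homogeneous≈0 {h} {u} {w} h-cong u≉0 w≉0 w≉1 h[ux]≈wh[x] = *-cancelʳ-≉ w≉1 (begin
    w * S F h                              ≈⟨ sum-map-* w (valueSet F h) ⟨
    sumList F (map (w *_) (valueSet F h))  ≈⟨ foldr-Unique-⊆-⊇ +-commutativeMonoid
                                                wV-! (valueSet-! h) wV⊆V V⊆wV ⟩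
    S F h                                  ≈⟨ *-identityˡ _ ⟨
    1# * S F h                             ∎)
    where
    wV-! : Unique (map (w *_) (valueSet F h))
    wV-! = map⁺ setoid setoid (*-cancelˡ-≉0 w≉0) (valueSet-! h)
    wV⊆V : map (w *_) (valueSet F h) ⊆ valueSet F h
    wV⊆V z∈ with x , z≈whx ← ∈-map-valueSet⁻ *-congˡ z∈ =
      ∈-resp-≈ setoid (sym (trans z≈whx (sym (h[ux]≈wh[x] x)))) (∈-valueSet⁺ h-cong (u * x))
    V⊆wV : valueSet F h ⊆ map (w *_) (valueSet F h)
    V⊆wV z∈ with x , z≈hx ← ∈-valueSet⁻ z∈ =
      ∈-resp-≈ setoid (sym (trans z≈hx (trans (h-cong (sym (x*[x⁻¹*y]≈y u≉0 x))) (h[ux]≈wh[x] _))))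
        (∈-map⁺ setoid setoid *-congˡ (∈-valueSet⁺ h-cong (x⁻¹ u≉0 * x)))

  fPoly-cong : ∀ r s B → fPoly F r s B Preserves _≈_ ⟶ _≈_
  fPoly-cong r s B {x} {y} x≈y = *-cong (pow-cong r) (eval-cong B (pow-cong s))
    where
    pow-cong : ∀ n → pow F x n ≈ pow F y n
    pow-cong n = trans (pow≈^ x n) (trans (^-congˡ n x≈y) (sym (pow≈^ y n)))

  fPoly-homogeneous : ∀ {u} r s B → u ^ s ≈ 1# → ∀ x → fPoly F r s B (u * x) ≈ u ^ r * fPoly F r s B x
  fPoly-homogeneous {u} r s B u^s≈1 x = begin
    pow F (u * x) r * eval F B (pow F (u * x) s)        ≈⟨ *-cong (pow-* r) (eval-cong B (pow-* s)) ⟩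
    (u ^ r * pow F x r) * eval F B (u ^ s * pow F x s)  ≈⟨ *-congˡ (eval-cong B u^s*x^s≈x^s) ⟩
    (u ^ r * pow F x r) * eval F B (pow F x s)          ≈⟨ *-assoc _ _ _ ⟩
    u ^ r * fPoly F r s B x                             ∎
    where
    pow-* : ∀ n → pow F (u * x) n ≈ u ^ n * pow F x n
    pow-* n = trans (pow≈^ (u * x) n) (trans (^-distrib-* u x n) (*-congˡ (sym (pow≈^ x n))))
    u^s*x^s≈x^s : u ^ s * pow F x s ≈ pow F x s
    u^s*x^s≈x^s = trans (*-congʳ u^s≈1) (*-identityˡ _)

corollary1p8 : (F : FiniteField) → (s r : ℕ) → s > 0 → s ∣ (order F ∸ 1) →
    r > 0 → ¬ (s ∣ r) → (B : Poly F) → (a : FiniteField.Carrier F) →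
    FiniteField._≈_ F
      (S F (λ x → FiniteField._+_ F (fPoly F r s B x) a))
      (FiniteField._*_ F a (fromℕ F (card F (fPoly F r s B))))
corollary1p8 F s r s>0 s∣q-1 _ s∤r B a
  with u , u≉0 , u^s≈1 , u^r≉1 ← ∃u^s≈1∧u^r≉1 F s>0 s∣q-1 s∤r = begin
    S F (λ x → f x + a)           ≈⟨ S-translate F (fPoly-cong F r s B) a ⟩
    S F f + a * fromℕ F (card F f) ≈⟨ +-congʳ (S-homogeneous≈0 F (fPoly-cong F r s B) u≉0 (^-≉0 F u≉0 r) u^r≉1
                                                (fPoly-homogeneous F r s B u^s≈1)) ⟩
    0# + a * fromℕ F (card F f)   ≈⟨ +-identityˡ _ ⟩
    a * fromℕ F (card F f)        ∎
  where
  open FiniteField F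
  open ≈-Reasoning setoid
  f = fPoly F r s B
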